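{- Let $\varphi:\mathbf{Toff}\to\mathbf{Move}$ be a $3$-functor which is strict on every generating $3$-cell of $\mathbf{Toff}$. Then $\varphi$ is strict, that is, strict on every $3$-cell of $\mathbf{Toff}$.
   Context: A $3$-functor between strict $3$-categories sends $i$-cells to $i$-cells and preserves sources, targets, identities and all compositions $\star_j$. $\mathbf{Toff}$ is the free strict $3$-category generated as follows. - It has one $0$-cell $\ast$. - It has one generating $1$-cell, the wire $\ast\to\ast$. Its $1$-cells are the natural numbers $n$ (bundles of $n$ wires), with $\star_0$ given by addition. - Its generating $2$-cells are $\mathtt{SWAP}:2\Rightarrow2$, $\mathtt{NOT}:1\Rightarrow1$, $\mathtt{T}_2:2\Rightarrow2$ and $\mathtt{T}_3:3\Rightarrow3$. Here $\star_0$ is parallel composition and $\star_1$ is sequential composition in diagrammatic order; $\mathrm{id}_n$ is the identity $2$-cell on $n$. Let - $P_3=(\mathtt{SWAP}\star_0\mathrm{id}_1)\star_1(\mathrm{id}_1\star_0\mathtt{SWAP})$; - $Q_3=(\mathrm{id}_1\star_0\mathtt{SWAP})\star_1(\mathtt{SWAP}\star_0\mathrm{id}_1)$; - $P_4=(\mathtt{SWAP}\star_0\mathrm{id}_2)\star_1(\mathrm{id}_1\star_0\mathtt{SWAP}\star_0\mathrm{id}_1)\star_1(\mathrm{id}_2\star_0\mathtt{SWAP})$; - $Q_4=(\mathrm{id}_2\star_0\mathtt{SWAP})\star_1(\mathrm{id}_1\star_0\mathtt{SWAP}\star_0\mathrm{id}_1)\star_1(\mathtt{SWAP}\star_0\mathrm{id}_2)$.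 The generating $3$-cells, written source $\Rrightarrow$ target, are: - $\mathtt{SWAP}\star_1\mathtt{SWAP}\Rrightarrow\mathrm{id}_2$; - $(\mathtt{SWAP}\star_0\mathrm{id}_1)\star_1(\mathrm{id}_1\star_0\mathtt{SWAP})\star_1(\mathtt{SWAP}\star_0\mathrm{id}_1)\Rrightarrow(\mathrm{id}_1\star_0\mathtt{SWAP})\star_1(\mathtt{SWAP}\star_0\mathrm{id}_1)\star_1(\mathrm{id}_1\star_0\mathtt{SWAP})$; - $\mathtt{NOT}\star_1\mathtt{NOT}\Rrightarrow\mathrm{id}_1$; - $\mathtt{T}_2\star_1\mathtt{T}_2\Rrightarrow\mathrm{id}_2$; - $\mathtt{T}_3\star_1\mathtt{T}_3\Rrightarrow\mathrm{id}_3$; - $\mathtt{SWAP}\star_1(\mathtt{NOT}\star_0\mathrm{id}_1)\Rrightarrow(\mathrm{id}_1\star_0\mathtt{NOT})\star_1\mathtt{SWAP}$; - $\mathtt{SWAP}\star_1(\mathrm{id}_1\star_0\mathtt{NOT})\Rrightarrow(\mathtt{NOT}\star_0\mathrm{id}_1)\star_1\mathtt{SWAP}$; - $P_3\star_1(\mathtt{T}_2\star_0\mathrm{id}_1)\Rrightarrow(\mathrm{id}_1\star_0\mathtt{T}_2)\star_1P_3$; - $Q_3\star_1(\mathrm{id}_1\star_0\mathtt{T}_2)\Rrightarrow(\mathtt{T}_2\star_0\mathrm{id}_1)\star_1Q_3$; - $P_4\star_1(\mathtt{T}_3\star_0\mathrm{id}_1)\Rrightarrow(\mathrm{id}_1\star_0\mathtt{T}_3)\star_1P_4$;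 - $Q_4\star_1(\mathrm{id}_1\star_0\mathtt{T}_3)\Rrightarrow(\mathtt{T}_3\star_0\mathrm{id}_1)\star_1Q_4$; - $(\mathtt{SWAP}\star_0\mathrm{id}_1)\star_1\mathtt{T}_3\Rrightarrow\mathtt{T}_3\star_1(\mathtt{SWAP}\star_0\mathrm{id}_1)$. $\mathbf{Move}$ is built from the following data. - ${\tt M}$ is the free monoid on $\{{\tt l},{\tt r},{\tt t}\}$. It is ordered by length, with words of equal length ordered lexicographically using ${\tt t}<{\tt r}<{\tt l}$. - ${\tt M}^n$ carries the product order; $\vec x<\vec y$ means componentwise $\le$ and $\vec x\ne\vec y$. The cells of $\mathbf{Move}$ are: - one $0$-cell $\ast$; - $1$-cells ${\tt M}^n$, with $\star_0$ giving ${\tt M}^{n+m}$; - $2$-cells: maps ${\tt M}^n\to{\tt M}^n$ strictly increasing for the product order, with $\star_0$ the cartesian product of maps and $f\star_1 g=g\circ f$; - $3$-cells: pairs $\langle f,g\rangle$ of parallel $2$-cells with either $f=g$ or $g(\vec x)<f(\vec x)$ for all $\vec x$. The $3$-cell $\langle f,g\rangle$ has source $f$ and target $g$. Its compositions are $\langle f,g\rangle\star_0\langle f',g'\rangle=\langle f\times f',g\times g'\rangle$, $\langle f,g\rangle\star_1\langle f',g'\rangle=\langle f'\circ f,g'\circ g\rangle$ and $\langle f,g\rangle\star_2\langle g,h\rangle=\langle f,h\rangle$. Its identities are the pairs $\langle f,f\rangle$. A $3$-functor $\varphi:\mathbf{Toff}\to\mathbf{Move}$ is strict on a $3$-cell $\alpha$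 if: $\alpha$ is an identity $3$-cell of $\mathbf{Toff}$ if and only if $\varphi(\alpha)$ is an identity $3$-cell of $\mathbf{Move}$. It is strict if it is strict on all $3$-cells of $\mathbf{Toff}$. -}

module Defs where

open import Data.Nat using (ℕ; zero; suc; _+_; _*_; _<_)
open import Data.List using (List; []; _∷_; length)
open import Data.Vec using (Vec; take; drop; _++_)
open import Data.Vec.Relation.Binary.Pointwise.Inductive using (Pointwise)
open import Data.Product using (Σ; _×_; _,_; proj₁; proj₂)
open import Data.Sum using (_⊎_)
open import Relation.Binary.PropositionalEquality using (_≡_; _≢_)

-- The free strict 3-category Toff
-- 0-cells: a single one (left implicit).
-- 1-cells: natural numbers n (bundles of n wires), ⋆₀ = addition.

data Gen2 : Set where
  SWAP NOT T₂ T₃ : Gen2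

ar : Gen2 → ℕ
ar SWAP = 2
ar NOT  = 1
ar T₂   = 2
ar T₃   = 3

infixl 7 _⋆₀_
infixl 6 _⋆₁_

data Cell2 : ℕ → ℕ → Set where
  gen  : (g : Gen2) → Cell2 (ar g) (ar g)
  id₂  : (n : ℕ) → Cell2 n n
  _⋆₀_ : ∀ {a b c d} → Cell2 a b → Cell2 c d → Cell2 (a + c) (b + d)
  _⋆₁_ : ∀ {a b c} → Cell2 a b → Cell2 b c → Cell2 a c

infix 4 _≈₂_

-- equality of 2-cells of the free strict 2-category: the congruence
-- generated by the axioms of strict 2-categories (heterogeneous in the
-- 1-cell indices, since e.g. (a+c)+e and a+(c+e) differ syntactically)
data _≈₂_ : ∀ {a b c d} → Cell2 a b → Cell2 c d → Set where
  ≈refl  : ∀ {a b} {f : Cell2 a b} → f ≈₂ f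
  ≈sym   : ∀ {a b c d} {f : Cell2 a b} {g : Cell2 c d} → f ≈₂ g → g ≈₂ f
  ≈trans : ∀ {a b c d e e'} {f : Cell2 a b} {g : Cell2 c d} {h : Cell2 e e'} →
           f ≈₂ g → g ≈₂ h → f ≈₂ h
  ⋆₀-cong : ∀ {a b c d a' b' c' d'} {f : Cell2 a b} {g : Cell2 c d}
              {f' : Cell2 a' b'} {g' : Cell2 c' d'} →
            f ≈₂ f' → g ≈₂ g' → f ⋆₀ g ≈₂ f' ⋆₀ g'
  ⋆₁-cong : ∀ {a b c a' b' c'} {f : Cell2 a b} {g : Cell2 b c}
              {f' : Cell2 a' b'} {g' : Cell2 b' c'} →
            f ≈₂ f' → g ≈₂ g' → f ⋆₁ g ≈₂ f' ⋆₁ g'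
  ⋆₀-assoc : ∀ {a b c d e e'} {f : Cell2 a b} {g : Cell2 c d} {h : Cell2 e e'} →
             (f ⋆₀ g) ⋆₀ h ≈₂ f ⋆₀ (g ⋆₀ h)
  ⋆₁-assoc : ∀ {a b c d} {f : Cell2 a b} {g : Cell2 b c} {h : Cell2 c d} →
             (f ⋆₁ g) ⋆₁ h ≈₂ f ⋆₁ (g ⋆₁ h)
  ⋆₀-unitˡ : ∀ {a b} {f : Cell2 a b} → id₂ 0 ⋆₀ f ≈₂ f
  ⋆₀-unitʳ : ∀ {a b} {f : Cell2 a b} → f ⋆₀ id₂ 0 ≈₂ f
  ⋆₁-unitˡ : ∀ {a b} {f : Cell2 a b} → id₂ a ⋆₁ f ≈₂ f
  ⋆₁-unitʳ : ∀ {a b} {f : Cell2 a b} → f ⋆₁ id₂ b ≈₂ f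
  id-⋆₀    : ∀ {m n} → id₂ m ⋆₀ id₂ n ≈₂ id₂ (m + n)
  interchange : ∀ {a b c a' b' c'} {f : Cell2 a b} {g : Cell2 b c}
                  {h : Cell2 a' b'} {k : Cell2 b' c'} →
                (f ⋆₁ g) ⋆₀ (h ⋆₁ k) ≈₂ (f ⋆₀ h) ⋆₁ (g ⋆₀ k)

SWAP' NOT' T₂' T₃' : _
SWAP' = gen SWAP
NOT'  = gen NOT
T₂'   = gen T₂
T₃'   = gen T₃

P₃ Q₃ : Cell2 3 3
P₃ = (SWAP' ⋆₀ id₂ 1) ⋆₁ (id₂ 1 ⋆₀ SWAP')
Q₃ = (id₂ 1 ⋆₀ SWAP') ⋆₁ (SWAP' ⋆₀ id₂ 1)

P₄ Q₄ : Cell2 4 4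
P₄ = (SWAP' ⋆₀ id₂ 2) ⋆₁ (id₂ 1 ⋆₀ SWAP' ⋆₀ id₂ 1) ⋆₁ (id₂ 2 ⋆₀ SWAP')
Q₄ = (id₂ 2 ⋆₀ SWAP') ⋆₁ (id₂ 1 ⋆₀ SWAP' ⋆₀ id₂ 1) ⋆₁ (SWAP' ⋆₀ id₂ 2)

data Gen3 : Set where
  swap-swap yang-baxter not-not t2-t2 t3-t3
    swap-notˡ swap-notʳ t2-P t2-Q t3-P t3-Q swap-t3 : Gen3

ar₃ : Gen3 → ℕ
ar₃ swap-swap   = 2
ar₃ yang-baxter = 3
ar₃ not-not     = 1
ar₃ t2-t2       = 2
ar₃ t3-t3       = 3
ar₃ swap-notˡ   = 2
ar₃ swap-notʳ   = 2
ar₃ t2-P        = 3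
ar₃ t2-Q        = 3
ar₃ t3-P        = 4
ar₃ t3-Q        = 4
ar₃ swap-t3     = 3

src₃ tgt₃ : (γ : Gen3) → Cell2 (ar₃ γ) (ar₃ γ)
src₃ swap-swap   = SWAP' ⋆₁ SWAP'
src₃ yang-baxter = (SWAP' ⋆₀ id₂ 1) ⋆₁ (id₂ 1 ⋆₀ SWAP') ⋆₁ (SWAP' ⋆₀ id₂ 1)
src₃ not-not     = NOT' ⋆₁ NOT'
src₃ t2-t2       = T₂' ⋆₁ T₂'
src₃ t3-t3       = T₃' ⋆₁ T₃'
src₃ swap-notˡ   = SWAP' ⋆₁ (NOT' ⋆₀ id₂ 1)
src₃ swap-notʳ   = SWAP' ⋆₁ (id₂ 1 ⋆₀ NOT')
src₃ t2-P        = P₃ ⋆₁ (T₂' ⋆₀ id₂ 1)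
src₃ t2-Q        = Q₃ ⋆₁ (id₂ 1 ⋆₀ T₂')
src₃ t3-P        = P₄ ⋆₁ (T₃' ⋆₀ id₂ 1)
src₃ t3-Q        = Q₄ ⋆₁ (id₂ 1 ⋆₀ T₃')
src₃ swap-t3     = (SWAP' ⋆₀ id₂ 1) ⋆₁ T₃'
tgt₃ swap-swap   = id₂ 2
tgt₃ yang-baxter = (id₂ 1 ⋆₀ SWAP') ⋆₁ (SWAP' ⋆₀ id₂ 1) ⋆₁ (id₂ 1 ⋆₀ SWAP')
tgt₃ not-not     = id₂ 1
tgt₃ t2-t2       = id₂ 2
tgt₃ t3-t3       = id₂ 3
tgt₃ swap-notˡ   = (id₂ 1 ⋆₀ NOT') ⋆₁ SWAP'
tgt₃ swap-notʳ   = (NOT' ⋆₀ id₂ 1) ⋆₁ SWAP'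
tgt₃ t2-P        = (id₂ 1 ⋆₀ T₂') ⋆₁ P₃
tgt₃ t2-Q        = (T₂' ⋆₀ id₂ 1) ⋆₁ Q₃
tgt₃ t3-P        = (id₂ 1 ⋆₀ T₃') ⋆₁ P₄
tgt₃ t3-Q        = (T₃' ⋆₀ id₂ 1) ⋆₁ Q₄
tgt₃ swap-t3     = T₃' ⋆₁ (SWAP' ⋆₀ id₂ 1)

infixl 7 _⋆₀'_
infixl 6 _⋆₁'_

-- 3-cell terms, indexed by source and target 2-cell terms.  ⋆₂ composes
-- along 2-cells that are equal in the free 2-category.
data Cell3 : ∀ {a b} → Cell2 a b → Cell2 a b → Set where
  gen₃  : (γ : Gen3) → Cell3 (src₃ γ) (tgt₃ γ)
  id₃   : ∀ {a b} (f : Cell2 a b) → Cell3 f f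
  _⋆₀'_ : ∀ {a b c d} {f g : Cell2 a b} {f' g' : Cell2 c d} →
          Cell3 f g → Cell3 f' g' → Cell3 (f ⋆₀ f') (g ⋆₀ g')
  _⋆₁'_ : ∀ {a b c} {f g : Cell2 a b} {f' g' : Cell2 b c} →
          Cell3 f g → Cell3 f' g' → Cell3 (f ⋆₁ f') (g ⋆₁ g')
  comp₂ : ∀ {a b} {f g g' h : Cell2 a b} →
          Cell3 f g → g ≈₂ g' → Cell3 g' h → Cell3 f h

infix 4 _≈₃_

data _≈₃_ : ∀ {a b a' b'} {f g : Cell2 a b} {f' g' : Cell2 a' b'} →
            Cell3 f g → Cell3 f' g' → Set where
  ≈refl  : ∀ {a b} {f g : Cell2 a b} {α : Cell3 f g} → α ≈₃ α
  ≈sym   : ∀ {a b a' b'} {f g : Cell2 a b} {f' g' : Cell2 a' b'}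
             {α : Cell3 f g} {β : Cell3 f' g'} → α ≈₃ β → β ≈₃ α
  ≈trans : ∀ {a b a' b' a'' b''} {f g : Cell2 a b} {f' g' : Cell2 a' b'}
             {f'' g'' : Cell2 a'' b''}
             {α : Cell3 f g} {β : Cell3 f' g'} {γ : Cell3 f'' g''} →
           α ≈₃ β → β ≈₃ γ → α ≈₃ γ
  ⋆₀-cong : ∀ {a b c d a' b' c' d'} {f g : Cell2 a b} {h k : Cell2 c d}
              {f' g' : Cell2 a' b'} {h' k' : Cell2 c' d'}
              {α : Cell3 f g} {β : Cell3 h k} {α' : Cell3 f' g'} {β' : Cell3 h' k'} →
            α ≈₃ α' → β ≈₃ β' → α ⋆₀' β ≈₃ α' ⋆₀' β'
  ⋆₁-cong : ∀ {a b c a' b' c'} {f g : Cell2 a b} {h k : Cell2 b c}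
              {f' g' : Cell2 a' b'} {h' k' : Cell2 b' c'}
              {α : Cell3 f g} {β : Cell3 h k} {α' : Cell3 f' g'} {β' : Cell3 h' k'} →
            α ≈₃ α' → β ≈₃ β' → α ⋆₁' β ≈₃ α' ⋆₁' β'
  ⋆₂-cong : ∀ {a b a' b'} {f g g₁ h : Cell2 a b} {f' g' g₁' h' : Cell2 a' b'}
              {α : Cell3 f g} {p : g ≈₂ g₁} {β : Cell3 g₁ h}
              {α' : Cell3 f' g'} {p' : g' ≈₂ g₁'} {β' : Cell3 g₁' h'} →
            α ≈₃ α' → β ≈₃ β' → comp₂ α p β ≈₃ comp₂ α' p' β'
  ⋆₀-assoc : ∀ {a b c d e e'} {f g : Cell2 a b} {h k : Cell2 c d} {u v : Cell2 e e'}
               {α : Cell3 f g} {β : Cell3 h k} {γ : Cell3 u v} →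
             (α ⋆₀' β) ⋆₀' γ ≈₃ α ⋆₀' (β ⋆₀' γ)
  ⋆₁-assoc : ∀ {a b c d} {f g : Cell2 a b} {h k : Cell2 b c} {u v : Cell2 c d}
               {α : Cell3 f g} {β : Cell3 h k} {γ : Cell3 u v} →
             (α ⋆₁' β) ⋆₁' γ ≈₃ α ⋆₁' (β ⋆₁' γ)
  ⋆₂-assoc : ∀ {a b} {f g g' h h' k : Cell2 a b}
               {α : Cell3 f g} {p : g ≈₂ g'} {β : Cell3 g' h} {q : h ≈₂ h'}
               {γ : Cell3 h' k} →
             comp₂ (comp₂ α p β) q γ ≈₃ comp₂ α p (comp₂ β q γ)
  ⋆₀-unitˡ : ∀ {a b} {f g : Cell2 a b} {α : Cell3 f g} → id₃ (id₂ 0) ⋆₀' α ≈₃ α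
  ⋆₀-unitʳ : ∀ {a b} {f g : Cell2 a b} {α : Cell3 f g} → α ⋆₀' id₃ (id₂ 0) ≈₃ α
  ⋆₁-unitˡ : ∀ {a b} {f g : Cell2 a b} {α : Cell3 f g} → id₃ (id₂ a) ⋆₁' α ≈₃ α
  ⋆₁-unitʳ : ∀ {a b} {f g : Cell2 a b} {α : Cell3 f g} → α ⋆₁' id₃ (id₂ b) ≈₃ α
  ⋆₂-unitˡ : ∀ {a b} {f f' g : Cell2 a b} {p : f ≈₂ f'} {α : Cell3 f' g} →
             comp₂ (id₃ f) p α ≈₃ α
  ⋆₂-unitʳ : ∀ {a b} {f g g' : Cell2 a b} {α : Cell3 f g} {p : g ≈₂ g'} →
             comp₂ α p (id₃ g') ≈₃ α
  id₃-cong : ∀ {a b a' b'} {f : Cell2 a b} {g : Cell2 a' b'} →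
             f ≈₂ g → id₃ f ≈₃ id₃ g
  id₃-⋆₀   : ∀ {a b c d} {f : Cell2 a b} {g : Cell2 c d} →
             id₃ f ⋆₀' id₃ g ≈₃ id₃ (f ⋆₀ g)
  id₃-⋆₁   : ∀ {a b c} {f : Cell2 a b} {g : Cell2 b c} →
             id₃ f ⋆₁' id₃ g ≈₃ id₃ (f ⋆₁ g)
  interchange₀₁ : ∀ {a b c a' b' c'} {f g : Cell2 a b} {h k : Cell2 b c}
                    {f' g' : Cell2 a' b'} {h' k' : Cell2 b' c'}
                    {α : Cell3 f g} {β : Cell3 h k} {γ : Cell3 f' g'} {δ : Cell3 h' k'} →
                  (α ⋆₁' β) ⋆₀' (γ ⋆₁' δ) ≈₃ (α ⋆₀' γ) ⋆₁' (β ⋆₀' δ)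
  interchange₀₂ : ∀ {a b c d} {f g g₁ h : Cell2 a b} {f' g' g₁' h' : Cell2 c d}
                    {α : Cell3 f g} {p : g ≈₂ g₁} {β : Cell3 g₁ h}
                    {γ : Cell3 f' g'} {q : g' ≈₂ g₁'} {δ : Cell3 g₁' h'} →
                  comp₂ α p β ⋆₀' comp₂ γ q δ ≈₃ comp₂ (α ⋆₀' γ) (⋆₀-cong p q) (β ⋆₀' δ)
  interchange₁₂ : ∀ {a b c} {f g g₁ h : Cell2 a b} {f' g' g₁' h' : Cell2 b c}
                    {α : Cell3 f g} {p : g ≈₂ g₁} {β : Cell3 g₁ h}
                    {γ : Cell3 f' g'} {q : g' ≈₂ g₁'} {δ : Cell3 g₁' h'} →
                  comp₂ α p β ⋆₁' comp₂ γ q δ ≈₃ comp₂ (α ⋆₁' γ) (⋆₁-cong p q) (β ⋆₁' δ)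

IsIdentityToff : ∀ {a b} {f g : Cell2 a b} → Cell3 f g → Set
IsIdentityToff {a} {b} α = Σ (Cell2 a b) λ h → α ≈₃ id₃ h

data Letter : Set where
  t r l : Letter

data _<Letter_ : Letter → Letter → Set where
  t<r : t <Letter r
  t<l : t <Letter l
  r<l : r <Letter l

M : Set
M = List Letter

data Lex : M → M → Set where
  here  : ∀ {x y xs ys} → x <Letter y → Lex (x ∷ xs) (y ∷ ys)
  there : ∀ {x xs ys} → Lex xs ys → Lex (x ∷ xs) (x ∷ ys)

_<M_ : M → M → Set
u <M v = length u < length v ⊎ (length u ≡ length v × Lex u v)

_≤M_ : M → M → Set
u ≤M v = u ≡ v ⊎ u <M v

_≤V_ : ∀ {n} → Vec M n → Vec M n → Set
x ≤V y = Pointwise _≤M_ x y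

_<V_ : ∀ {n} → Vec M n → Vec M n → Set
x <V y = x ≤V y × x ≢ y

-- 2-cells of Move: strictly increasing maps M^n → M^n
StrictlyIncreasing : ∀ {n m} → (Vec M n → Vec M m) → Set
StrictlyIncreasing F = ∀ {x y} → x <V y → F x <V F y

IsMove3 : ∀ {n m} → (Vec M n → Vec M m) → (Vec M n → Vec M m) → Set
IsMove3 F G = (∀ x → F x ≡ G x) ⊎ (∀ x → G x <V F x)

IsIdentityMove : ∀ {n m} → (Vec M n → Vec M m) → (Vec M n → Vec M m) → Set
IsIdentityMove F G = ∀ x → F x ≡ G x

-- M^((a+c)k) ≅ M^(ak) × M^(ck), splitting into blocks of size k
split : ∀ {A : Set} k a {c} → Vec A ((a + c) * k) → Vec A (a * k) × Vec A (c * k)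
split k zero    xs = Data.Vec.[] , xs
split k (suc a) xs = (take k xs ++ proj₁ (split k a (drop k xs))) , proj₂ (split k a (drop k xs))

join : ∀ {A : Set} k a {c} → Vec A (a * k) → Vec A (c * k) → Vec A ((a + c) * k)
join k zero    xs ys = ys
join k (suc a) xs ys = take k xs ++ join k a (drop k xs) ys

_×ₘ_ : ∀ {k a b c d} → (Vec M (a * k) → Vec M (b * k)) → (Vec M (c * k) → Vec M (d * k)) →
       Vec M ((a + c) * k) → Vec M ((b + d) * k)
_×ₘ_ {k} {a} {b} F G x = join k b (F (proj₁ (split k a x))) (G (proj₂ (split k a x)))

-- The 1-cell functor is determined by the
-- image M^k of the generating wire: n ↦ M^(n*k).  A 3-cell α : f ⇛ g must go
-- to the 3-cell ⟨φ₂ f , φ₂ g⟩ of Move (3-cells of Move are determined by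
-- their source and target), so the remaining data is that this pair is a
-- 3-cell of Move; preservation of ⋆₀, ⋆₁, ⋆₂ and identities on 3-cells is
-- then automatic.
record Functor3 : Set where
  field
    k      : ℕ
    φ₂     : ∀ {a b} → Cell2 a b → Vec M (a * k) → Vec M (b * k)
    φ₂-inc : ∀ {a b} (f : Cell2 a b) → StrictlyIncreasing (φ₂ f)
    φ₂-resp : ∀ {a b} {f g : Cell2 a b} → f ≈₂ g → ∀ x → φ₂ f x ≡ φ₂ g x
    φ₂-id  : ∀ n x → φ₂ (id₂ n) x ≡ x
    φ₂-⋆₁  : ∀ {a b c} (f : Cell2 a b) (g : Cell2 b c) x →
             φ₂ (f ⋆₁ g) x ≡ φ₂ g (φ₂ f x)
    φ₂-⋆₀  : ∀ {a b c d} (f : Cell2 a b) (g : Cell2 c d) x →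
             φ₂ (f ⋆₀ g) x ≡ (_×ₘ_ {k} {a} {b} {c} {d} (φ₂ f) (φ₂ g)) x
    φ₃     : ∀ {a b} {f g : Cell2 a b} → Cell3 f g → IsMove3 (φ₂ f) (φ₂ g)

open Functor3 public

StrictOn : (φ : Functor3) → ∀ {a b} {f g : Cell2 a b} → Cell3 f g → Set
StrictOn φ {f = f} {g = g} α =
  (IsIdentityToff α → IsIdentityMove (φ₂ φ f) (φ₂ φ g)) ×
  (IsIdentityMove (φ₂ φ f) (φ₂ φ g) → IsIdentityToff α)

{-# OPTIONS --safe #-}
-- A 3-cell of Move is either an identity or strictly decreasing at every point,
-- and its source dominates its target pointwise. Hence, in Move, a composite of
-- 3-cells is an identity only if every factor is: for ⋆₂ by antisymmetry of the
-- product order, for ⋆₁ because 2-cells are strictly increasing, and for ⋆₀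
-- because a cartesian product of maps determines its factors (M^n is never
-- empty). Induction on 3-cell terms then reduces strictness of φ to the
-- generators; the other direction holds because identity 3-cells have equal
-- source and target.
module Submission where

open import Defs
open import Data.Nat using (ℕ; _*_)
open import Data.Nat.Properties using (<-irrefl; <-asym)
open import Data.List using ([])
open import Data.Vec as Vec using (Vec; take; drop; _++_; replicate)
open import Data.Vec.Properties using (take++drop≡id; ++-injective)
open import Data.Vec.Relation.Binary.Pointwise.Inductive as Pointwise using ([]; _∷_)
open import Data.Product using (_×_; _,_; proj₁; proj₂)
open import Data.Sum using (inj₁; inj₂)
open import Data.Empty using (⊥-elim)
open import Function using (_∘_)
open import Relation.Nullary using (¬_)
open import Relation.Binary.PropositionalEquality

<Letter-irrefl : ∀ {x} → ¬ (x <Letter x)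
<Letter-irrefl ()

<Letter-asym : ∀ {x y} → x <Letter y → ¬ (y <Letter x)
<Letter-asym t<r ()
<Letter-asym t<l ()
<Letter-asym r<l ()

Lex-asym : ∀ {u v} → Lex u v → ¬ Lex v u
Lex-asym (here p)  (here q)  = <Letter-asym p q
Lex-asym (here p)  (there q) = <Letter-irrefl p
Lex-asym (there p) (here q)  = <Letter-irrefl q
Lex-asym (there p) (there q) = Lex-asym p q

<M-asym : ∀ {u v} → u <M v → ¬ (v <M u)
<M-asym (inj₁ p)       (inj₁ q)       = <-asym p q
<M-asym (inj₁ p)       (inj₂ (e , _)) = <-irrefl (sym e) p
<M-asym (inj₂ (e , _)) (inj₁ q)       = <-irrefl (sym e) q
<M-asym (inj₂ (_ , p)) (inj₂ (_ , q)) = Lex-asym p q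

≤M-antisym : ∀ {u v} → u ≤M v → v ≤M u → u ≡ v
≤M-antisym (inj₁ u≡v) _          = u≡v
≤M-antisym (inj₂ _)   (inj₁ v≡u) = sym v≡u
≤M-antisym (inj₂ p)   (inj₂ q)   = ⊥-elim (<M-asym p q)

≤V-refl : ∀ {n} {x : Vec M n} → x ≤V x
≤V-refl = Pointwise.refl (inj₁ refl)

≤V-antisym : ∀ {n} {x y : Vec M n} → x ≤V y → y ≤V x → x ≡ y
≤V-antisym []       []       = refl
≤V-antisym (p ∷ ps) (q ∷ qs) = cong₂ Vec._∷_ (≤M-antisym p q) (≤V-antisym ps qs)

<V⇒≱V : ∀ {n} {x y : Vec M n} → x <V y → ¬ (y ≤V x)
<V⇒≱V (x≤y , x≢y) y≤x = x≢y (≤V-antisym x≤y y≤x)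

≤V-squeeze : ∀ {n} {x y z : Vec M n} → x ≤V y → y ≤V z → z ≡ x → x ≡ y × y ≡ z
≤V-squeeze x≤y y≤z refl = ≤V-antisym x≤y y≤z , ≤V-antisym y≤z x≤y

take-++ : ∀ {A : Set} {m n} (u : Vec A m) (v : Vec A n) → take m (u ++ v) ≡ u
take-++ {m = m} u v = proj₁ (++-injective _ u (take++drop≡id m (u ++ v)))

drop-++ : ∀ {A : Set} {m n} (u : Vec A m) (v : Vec A n) → drop m (u ++ v) ≡ v
drop-++ {m = m} u v = proj₂ (++-injective _ u (take++drop≡id m (u ++ v)))

split-join : ∀ {A : Set} k a {c} (x : Vec A (a * k)) (y : Vec A (c * k)) →
             split k a {c} (join k a {c} x y) ≡ (x , y)
split-join k ℕ.zero    Vec.[] y = refl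
split-join k (ℕ.suc a) {c} x y
  rewrite take-++ (take k x) (join k a {c} (drop k x) y)
        | drop-++ (take k x) (join k a {c} (drop k x) y)
        | split-join k a {c} (drop k x) y
        | take++drop≡id k x = refl

module _ {n m : ℕ} {F G : Vec M n → Vec M m} where

  IsMove3⇒≥ : IsMove3 F G → ∀ x → G x ≤V F x
  IsMove3⇒≥ (inj₁ F≗G) x rewrite F≗G x = ≤V-refl
  IsMove3⇒≥ (inj₂ G<F) x = proj₁ (G<F x)

  IsMove3-identityAt : IsMove3 F G → ∀ x → F x ≡ G x → IsIdentityMove F G
  IsMove3-identityAt (inj₁ F≗G) _ _     = F≗G
  IsMove3-identityAt (inj₂ G<F) x Fx≡Gx = ⊥-elim (proj₂ (G<F x) (sym Fx≡Gx))

IsIdentityMove-⋆₂⁻ : ∀ {n m} {F G G' H : Vec M n → Vec M m} →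
                     IsMove3 F G → IsIdentityMove G G' → IsMove3 G' H →
                     IsIdentityMove F H → IsIdentityMove F G × IsIdentityMove G' H
IsIdentityMove-⋆₂⁻ {F = F} {G} {H = H} FG G≗G' G'H F≗H =
  (λ x → sym (proj₂ (squeeze x))) ,
  (λ x → trans (sym (G≗G' x)) (sym (proj₁ (squeeze x))))
  where
    squeeze : ∀ x → H x ≡ G x × G x ≡ F x
    squeeze x = ≤V-squeeze (subst (H x ≤V_) (sym (G≗G' x)) (IsMove3⇒≥ G'H x))
                           (IsMove3⇒≥ FG x) (F≗H x)

IsIdentityMove-∘⁻ : ∀ {a b c} {F G : Vec M a → Vec M b} {F' G' : Vec M b → Vec M c} →
                    StrictlyIncreasing G' → IsMove3 F G → IsMove3 F' G' →
                    IsIdentityMove (F' ∘ F) (G' ∘ G) →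
                    IsIdentityMove F G × IsIdentityMove F' G'
IsIdentityMove-∘⁻ {a} {F = F} {G} {F'} {G'} G'-inc FG F'G' F'F≗G'G =
  F≗G , IsMove3-identityAt F'G' (F x₀) (trans (F'F≗G'G x₀) (cong G' (sym (F≗G x₀))))
  where
    x₀ = replicate a []
    G'F≤G'G : ∀ x → G' (F x) ≤V G' (G x)
    G'F≤G'G x = subst (G' (F x) ≤V_) (F'F≗G'G x) (IsMove3⇒≥ F'G' (F x))
    -- G x < F x would give G' (G x) < G' (F x) ≤ F' (F x) = G' (G x).
    IsMove3⇒F≗G : IsMove3 F G → IsIdentityMove F G
    IsMove3⇒F≗G (inj₁ F≗G) = F≗G
    IsMove3⇒F≗G (inj₂ G<F) x = ⊥-elim (<V⇒≱V (G'-inc (G<F x)) (G'F≤G'G x))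
    F≗G : IsIdentityMove F G
    F≗G = IsMove3⇒F≗G FG

module _ {k a b c d : ℕ} where

  ×ₘ-join : (F : Vec M (a * k) → Vec M (b * k)) (F' : Vec M (c * k) → Vec M (d * k))
            (x : Vec M (a * k)) (y : Vec M (c * k)) →
            split k b {d} (_×ₘ_ {k} {a} {b} {c} {d} F F' (join k a {c} x y)) ≡ (F x , F' y)
  ×ₘ-join F F' x y rewrite split-join k a {c} x y = split-join k b {d} (F x) (F' y)

  IsIdentityMove-×ₘ⁻ : {F G : Vec M (a * k) → Vec M (b * k)} {F' G' : Vec M (c * k) → Vec M (d * k)} →
                       IsIdentityMove (_×ₘ_ {k} {a} {b} {c} {d} F F') (_×ₘ_ {k} {a} {b} {c} {d} G G') →
                       IsIdentityMove F G × IsIdentityMove F' G'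
  IsIdentityMove-×ₘ⁻ {F} {G} {F'} {G'} I =
    (λ x → cong proj₁ (components x (replicate (c * k) []))) ,
    (λ y → cong proj₂ (components (replicate (a * k) []) y))
    where
      components : ∀ x y → (F x , F' y) ≡ (G x , G' y)
      components x y = begin
        (F x , F' y)                                  ≡⟨ ×ₘ-join F F' x y ⟨
        split k b (_×ₘ_ {k} {a} {b} {c} {d} F F' z)   ≡⟨ cong (split k b) (I z) ⟩
        split k b (_×ₘ_ {k} {a} {b} {c} {d} G G' z)   ≡⟨ ×ₘ-join G G' x y ⟩
        (G x , G' y)                                  ∎
        where open ≡-Reasoning
              z = join k a {c} x y

≈₃-boundaries : ∀ {a b a' b'} {f g : Cell2 a b} {f' g' : Cell2 a' b'}
                {α : Cell3 f g} {β : Cell3 f' g'} → α ≈₃ β → f ≈₂ f' × g ≈₂ g'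
≈₃-boundaries ≈refl            = ≈refl , ≈refl
≈₃-boundaries (≈sym e)         = let p , q = ≈₃-boundaries e in ≈sym p , ≈sym q
≈₃-boundaries (≈trans e e')    = let p , q = ≈₃-boundaries e ; p' , q' = ≈₃-boundaries e'
                                 in ≈trans p p' , ≈trans q q'
≈₃-boundaries (⋆₀-cong e e')   = let p , q = ≈₃-boundaries e ; p' , q' = ≈₃-boundaries e'
                                 in ⋆₀-cong p p' , ⋆₀-cong q q'
≈₃-boundaries (⋆₁-cong e e')   = let p , q = ≈₃-boundaries e ; p' , q' = ≈₃-boundaries e'
                                 in ⋆₁-cong p p' , ⋆₁-cong q q'
≈₃-boundaries (⋆₂-cong e e')   = proj₁ (≈₃-boundaries e) , proj₂ (≈₃-boundaries e')
≈₃-boundaries ⋆₀-assoc         = ⋆₀-assoc , ⋆₀-assoc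
≈₃-boundaries ⋆₁-assoc         = ⋆₁-assoc , ⋆₁-assoc
≈₃-boundaries ⋆₂-assoc         = ≈refl , ≈refl
≈₃-boundaries ⋆₀-unitˡ         = ⋆₀-unitˡ , ⋆₀-unitˡ
≈₃-boundaries ⋆₀-unitʳ         = ⋆₀-unitʳ , ⋆₀-unitʳ
≈₃-boundaries ⋆₁-unitˡ         = ⋆₁-unitˡ , ⋆₁-unitˡ
≈₃-boundaries ⋆₁-unitʳ         = ⋆₁-unitʳ , ⋆₁-unitʳ
≈₃-boundaries (⋆₂-unitˡ {p = p}) = p , ≈refl
≈₃-boundaries (⋆₂-unitʳ {p = p}) = ≈refl , ≈sym p
≈₃-boundaries (id₃-cong p)     = p , p
≈₃-boundaries id₃-⋆₀           = ≈refl , ≈refl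
≈₃-boundaries id₃-⋆₁           = ≈refl , ≈refl
≈₃-boundaries interchange₀₁    = interchange , interchange
≈₃-boundaries interchange₀₂    = ≈refl , ≈refl
≈₃-boundaries interchange₁₂    = ≈refl , ≈refl

IsIdentityToff⇒≈₂ : ∀ {a b} {f g : Cell2 a b} {α : Cell3 f g} → IsIdentityToff α → f ≈₂ g
IsIdentityToff⇒≈₂ (_ , α≈id) = let f≈h , g≈h = ≈₃-boundaries α≈id in ≈trans f≈h (≈sym g≈h)

IsIdentityToff-⋆₀ : ∀ {a b c d} {f g : Cell2 a b} {f' g' : Cell2 c d}
                    {α : Cell3 f g} {β : Cell3 f' g'} →
                    IsIdentityToff α → IsIdentityToff β → IsIdentityToff (α ⋆₀' β)
IsIdentityToff-⋆₀ (h , α≈id) (h' , β≈id) = h ⋆₀ h' , ≈trans (⋆₀-cong α≈id β≈id) id₃-⋆₀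

IsIdentityToff-⋆₁ : ∀ {a b c} {f g : Cell2 a b} {f' g' : Cell2 b c}
                    {α : Cell3 f g} {β : Cell3 f' g'} →
                    IsIdentityToff α → IsIdentityToff β → IsIdentityToff (α ⋆₁' β)
IsIdentityToff-⋆₁ (h , α≈id) (h' , β≈id) = h ⋆₁ h' , ≈trans (⋆₁-cong α≈id β≈id) id₃-⋆₁

IsIdentityToff-⋆₂ : ∀ {a b} {f g g' h : Cell2 a b} {α : Cell3 f g} {p : g ≈₂ g'} {β : Cell3 g' h} →
                    IsIdentityToff α → IsIdentityToff β → IsIdentityToff (comp₂ α p β)
IsIdentityToff-⋆₂ {p = p} (e , α≈id) (e' , β≈id) =
  e' , ≈trans (⋆₂-cong {p' = e≈e'} α≈id β≈id) ⋆₂-unitˡ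
  where
    e≈e' = ≈trans (≈sym (proj₂ (≈₃-boundaries α≈id))) (≈trans p (proj₁ (≈₃-boundaries β≈id)))

module _ (φ : Functor3) where

  φ-preserves-identities : ∀ {a b} {f g : Cell2 a b} (α : Cell3 f g) →
                           IsIdentityToff α → IsIdentityMove (φ₂ φ f) (φ₂ φ g)
  φ-preserves-identities _ = φ₂-resp φ ∘ IsIdentityToff⇒≈₂

  φ-reflects-identities : ((γ : Gen3) → StrictOn φ (gen₃ γ)) →
                          ∀ {a b} {f g : Cell2 a b} (α : Cell3 f g) →
                          IsIdentityMove (φ₂ φ f) (φ₂ φ g) → IsIdentityToff α
  φ-reflects-identities strict (gen₃ γ) = proj₂ (strict γ)
  φ-reflects-identities strict (id₃ f) _ = f , ≈refl
  φ-reflects-identities strict (_⋆₀'_ {a} {b} {c} {d} {f} {g} {f'} {g'} α β) I =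
    let Iα , Iβ = IsIdentityMove-×ₘ⁻ {k φ} {a} {b} {c} {d}
                    (λ x → trans (sym (φ₂-⋆₀ φ f f' x)) (trans (I x) (φ₂-⋆₀ φ g g' x)))
    in IsIdentityToff-⋆₀ (φ-reflects-identities strict α Iα) (φ-reflects-identities strict β Iβ)
  φ-reflects-identities strict (_⋆₁'_ {f = f} {g} {f'} {g'} α β) I =
    let Iα , Iβ = IsIdentityMove-∘⁻ (φ₂-inc φ g') (φ₃ φ α) (φ₃ φ β)
                    (λ x → trans (sym (φ₂-⋆₁ φ f f' x)) (trans (I x) (φ₂-⋆₁ φ g g' x)))
    in IsIdentityToff-⋆₁ (φ-reflects-identities strict α Iα) (φ-reflects-identities strict β Iβ)
  φ-reflects-identities strict (comp₂ α p β) I =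
    let Iα , Iβ = IsIdentityMove-⋆₂⁻ (φ₃ φ α) (φ₂-resp φ p) (φ₃ φ β) I
    in IsIdentityToff-⋆₂ (φ-reflects-identities strict α Iα) (φ-reflects-identities strict β Iβ)

proposition2 : (φ : Functor3) → ((γ : Gen3) → StrictOn φ (gen₃ γ)) →
               ∀ {a b} {f g : Cell2 a b} (α : Cell3 f g) → StrictOn φ α
proposition2 φ strict α = φ-preserves-identities φ α , φ-reflects-identities φ strict α
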